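{- If $(C_1,F_1)$ and $(C_2,F_2)$ are antlers in an undirected multigraph $G$, then $|C_1\cap F_2|=|C_2\cap F_1|$.
   Context: Graphs are undirected multigraphs, possibly with self-loops and parallel edges (these count as cycles). A feedback vertex set (FVS) of $G$ is a set $X\subseteq V(G)$ with $G-X$ acyclic; $\mathrm{fvs}(G)$ is its minimum size. For disjoint vertex sets $X,Y$, $e(X,Y)$ is the number of edges between them. A feedback vertex cut (FVC) in $G$ is a pair of disjoint sets $C,F\subseteq V(G)$ such that $G[F]$ is a forest and every tree $T$ of $G[F]$ satisfies $e(V(T),V(G)\setminus(C\cup F))\le1$. An antler in $G$ is an FVC $(C,F)$ with $|C|\le\mathrm{fvs}(G[C\cup F])$. -}

module Defs where

open import Data.Nat using (ℕ; suc; _≤_)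
open import Data.Nat.DivMod using (_%_; m%n<n)
open import Data.Fin using (Fin; toℕ; fromℕ<)
open import Data.Fin.Subset using (Subset; _∈_; _∉_; _⊆_; _∩_; _∪_; _─_; ∁; ∣_∣; Empty)
open import Data.Product using (_×_; _,_; proj₁; proj₂; Σ)
open import Data.Sum using (_⊎_)
open import Data.Empty using (⊥)
open import Relation.Binary.PropositionalEquality using (_≡_; _≢_)
open import Function.Definitions using (Injective)

-- Self-loops (equal
-- endpoints) and parallel edges (distinct indices with the same endpoints)
-- are allowed.
record Multigraph : Set where
  field
    n    : ℕ
    m    : ℕ
    ends : Fin m → Fin n × Fin n

module _ (G : Multigraph) where
  open Multigraph G

  V : Set
  V = Fin n

  VSet : Set
  VSet = Subset n

  Joins : Fin m → V → V → Set
  Joins e u v = (ends e ≡ (u , v)) ⊎ (ends e ≡ (v , u))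

  next : ∀ {k} → Fin (suc k) → Fin (suc k)
  next {k} i = fromℕ< (m%n<n (suc (toℕ i)) (suc k))

  -- Length 1 = self-loop,
  -- length 2 = pair of parallel edges.
  record CycleIn (S : VSet) : Set where
    field
      k      : ℕ
      vs     : Fin (suc k) → V
      es     : Fin (suc k) → Fin m
      vs-inj : Injective _≡_ _≡_ vs
      es-inj : Injective _≡_ _≡_ es
      vs-in  : ∀ i → vs i ∈ S
      adj    : ∀ i → Joins (es i) (vs i) (vs (next i))

  IsForest : VSet → Set
  IsForest S = CycleIn S → ⊥

  data Reach (S : VSet) (u : V) : V → Set where
    here : u ∈ S → Reach S u u
    step : ∀ {v w} e → Reach S u v → w ∈ S → Joins e v w → Reach S u w

  IsFVSOf : VSet → VSet → Set
  IsFVSOf H X = X ⊆ H × IsForest (H ─ X)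

  -- k ≤ fvs(G[H]), i.e. every feedback vertex set of G[H] has size ≥ k
  FvsAtLeast : VSet → ℕ → Set
  FvsAtLeast H k = ∀ X → IsFVSOf H X → k ≤ ∣ X ∣

  Disjoint : VSet → VSet → Set
  Disjoint A B = Empty (A ∩ B)

  EdgeBetweenTreeAnd : VSet → V → VSet → Fin m → Set
  EdgeBetweenTreeAnd F t R e =
    Σ V λ a → Σ V λ b → Joins e a b × Reach F t a × b ∈ R

  record IsFVC (C F : VSet) : Set where
    field
      disjoint : Disjoint C F
      forest   : IsForest F
      -- every tree T of G[F] (T = the component of some t ∈ F) has
      -- e(V(T), V(G) ∖ (C ∪ F)) ≤ 1: no two distinct such edges
      oneEdge  : ∀ t → t ∈ F → ∀ e₁ e₂ →
                 EdgeBetweenTreeAnd F t (∁ (C ∪ F)) e₁ →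
                 EdgeBetweenTreeAnd F t (∁ (C ∪ F)) e₂ → e₁ ≡ e₂

  record IsAntler (C F : VSet) : Set where
    field
      fvc  : IsFVC C F
      size : FvsAtLeast (C ∪ F) ∣ C ∣

-- Let X = (C₁ ∖ F₂) ∪ (C₂ ∩ F₁).  A cycle of G[C₁ ∪ F₁] avoiding X avoids
-- C₂, and a cycle avoiding the cut side C₂ of a feedback vertex cut cannot
-- meet F₂: walking around it from a vertex of F₂, it would leave and re-enter
-- that vertex's tree of G[F₂] through two distinct edges to the rest of the
-- graph.  So the cycle lies in G[F₁], which is a forest.  Hence X is a
-- feedback vertex set of G[C₁ ∪ F₁], and the antler condition gives
-- |C₁ ∖ F₂| + |C₁ ∩ F₂| = |C₁| ≤ |X| ≤ |C₁ ∖ F₂| + |C₂ ∩ F₁|.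
-- Exchanging the two antlers gives the reverse inequality.
module Submission where

open import Defs
open import Data.Fin.Subset using (_∩_; ∣_∣)
open import Relation.Binary.PropositionalEquality using (_≡_)

open import Data.Nat using (ℕ; zero; suc; _+_; _∸_; _≤_; _%_; z≤n; s≤s)
open import Data.Nat.Properties
  using (+-suc; +-identityʳ; +-assoc; +-comm; ≤-trans; ≤-reflexive; ≤-antisym; +-cancelˡ-≤; +-monoʳ-≤; n≤1+n; m+[n∸m]≡n; <⇒≤; module ≤-Reasoning)
open import Data.Nat.DivMod using (m%n<n; %-distribˡ-+; m%n%n≡m%n; [m+n]%n≡m%n; m<n⇒m%n≡m)
open import Data.Nat.GeneralisedArithmetic using (iterate)
open import Data.Fin using (Fin; toℕ)
open import Data.Fin.Properties using (toℕ-injective; toℕ-fromℕ<; toℕ<n; all?; ¬∀⟶∃¬)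
open import Data.Fin.Subset using (Subset; inside; outside; _∈_; _∉_; _⊆_; _∪_; _─_; ∁)
open import Data.Fin.Subset.Properties
  using (_∈?_; x∈p∪q⁻; x∈p∪q⁺; x∈p∩q⁻; x∈p∩q⁺; x∉p⇒x∈∁p; x∈∁p⇒x∉p; x∈p∧x∉q⇒x∈p─q; p─q⊆p)
open import Data.Vec using ([]; _∷_; here; there)
open import Data.Product using (_×_; _,_; proj₁; proj₂; ∃; ∃-syntax)
open import Data.Sum using (_⊎_; inj₁; inj₂; [_,_]′)
open import Function using (_∘_)
open import Data.Empty using (⊥; ⊥-elim)
open import Relation.Nullary using (¬_; yes; no)
open import Relation.Binary.PropositionalEquality using (refl; sym; trans; cong; subst; module ≡-Reasoning)

x∈p─q⇒x∉q : ∀ {n} (p q : Subset n) {x} → x ∈ p ─ q → x ∉ q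
x∈p─q⇒x∉q (_ ∷ p) (outside ∷ q) here        ()
x∈p─q⇒x∉q (_ ∷ p) (_       ∷ q) (there x∈) (there x∈q) = x∈p─q⇒x∉q p q x∈ x∈q

∣p∣≡∣p─q∣+∣p∩q∣ : ∀ {n} (p q : Subset n) → ∣ p ∣ ≡ ∣ p ─ q ∣ + ∣ p ∩ q ∣
∣p∣≡∣p─q∣+∣p∩q∣ []            []            = refl
∣p∣≡∣p─q∣+∣p∩q∣ (inside  ∷ p) (inside  ∷ q) =
  trans (cong suc (∣p∣≡∣p─q∣+∣p∩q∣ p q)) (sym (+-suc _ _))
∣p∣≡∣p─q∣+∣p∩q∣ (inside  ∷ p) (outside ∷ q) = cong suc (∣p∣≡∣p─q∣+∣p∩q∣ p q)
∣p∣≡∣p─q∣+∣p∩q∣ (outside ∷ p) (inside  ∷ q) = ∣p∣≡∣p─q∣+∣p∩q∣ p q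
∣p∣≡∣p─q∣+∣p∩q∣ (outside ∷ p) (outside ∷ q) = ∣p∣≡∣p─q∣+∣p∩q∣ p q

∣p∪q∣≤∣p∣+∣q∣ : ∀ {n} (p q : Subset n) → ∣ p ∪ q ∣ ≤ ∣ p ∣ + ∣ q ∣
∣p∪q∣≤∣p∣+∣q∣ []            []            = z≤n
∣p∪q∣≤∣p∣+∣q∣ (inside  ∷ p) (inside  ∷ q) =
  s≤s (≤-trans (∣p∪q∣≤∣p∣+∣q∣ p q) (+-monoʳ-≤ ∣ p ∣ (n≤1+n ∣ q ∣)))
∣p∪q∣≤∣p∣+∣q∣ (inside  ∷ p) (outside ∷ q) = s≤s (∣p∪q∣≤∣p∣+∣q∣ p q)
∣p∪q∣≤∣p∣+∣q∣ (outside ∷ p) (inside  ∷ q) =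
  ≤-trans (s≤s (∣p∪q∣≤∣p∣+∣q∣ p q)) (≤-reflexive (sym (+-suc ∣ p ∣ ∣ q ∣)))
∣p∪q∣≤∣p∣+∣q∣ (outside ∷ p) (outside ∷ q) = ∣p∪q∣≤∣p∣+∣q∣ p q

module _ {A : Set} (f : A → A) {P E : A → Set} where

  iterate-forward : (∀ x → P x → P (f x) ⊎ E x) →
                    ∀ d {x} → P x → ∃ E ⊎ P (iterate f x d)
  iterate-forward move zero    Px = inj₂ Px
  iterate-forward move (suc d) {x} Px with move x Px
  ... | inj₁ Pfx = iterate-forward move d Pfx
  ... | inj₂ Ex  = inj₁ (x , Ex)

  iterate-backward : (∀ x → P (f x) → P x ⊎ E x) →
                     ∀ d {x} → P (iterate f x d) → ∃ E ⊎ P x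
  iterate-backward move zero    Px = inj₂ Px
  iterate-backward move (suc d) {x} Pfdx with iterate-backward move d Pfdx
  ... | inj₁ ∃E  = inj₁ ∃E
  ... | inj₂ Pfx with move x Pfx
  ...   | inj₁ Px = inj₂ Px
  ...   | inj₂ Ex = inj₁ (x , Ex)

module _ (G : Multigraph) where
  open Multigraph G

  Joins-sym : ∀ {e u v} → Joins G e u v → Joins G e v u
  Joins-sym (inj₁ eq) = inj₂ eq
  Joins-sym (inj₂ eq) = inj₁ eq

  Reach⇒∈ : ∀ {S u v} → Reach G S u v → v ∈ S
  Reach⇒∈ (here u∈S)       = u∈S
  Reach⇒∈ (step _ _ w∈S _) = w∈S

  restrict : ∀ {S T} (c : CycleIn G S) → (∀ i → CycleIn.vs c i ∈ T) → CycleIn G T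
  restrict c vs∈T = record { CycleIn c; vs-in = vs∈T }

  toℕ-iterate-next : ∀ {k} d (i : Fin (suc k)) →
                     toℕ (iterate (next G) i d) ≡ (toℕ i + d) % suc k
  toℕ-iterate-next {k} zero i = begin
    toℕ i                 ≡⟨ sym (m<n⇒m%n≡m (toℕ<n i)) ⟩
    toℕ i % suc k         ≡⟨ cong (_% suc k) (sym (+-identityʳ (toℕ i))) ⟩
    (toℕ i + 0) % suc k   ∎
    where open ≡-Reasoning
  toℕ-iterate-next {k} (suc d) i = begin
    toℕ (iterate (next G) (next G i) d)         ≡⟨ toℕ-iterate-next d (next G i) ⟩
    (toℕ (next G i) + d) % suc k                ≡⟨ cong (λ m → (m + d) % suc k) (toℕ-fromℕ< (m%n<n (suc (toℕ i)) (suc k))) ⟩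
    (suc (toℕ i) % suc k + d) % suc k           ≡⟨ %-distribˡ-+ (suc (toℕ i) % suc k) d (suc k) ⟩
    (suc (toℕ i) % suc k % suc k + d % suc k) % suc k
      ≡⟨ cong (λ m → (m + d % suc k) % suc k) (m%n%n≡m%n (suc (toℕ i)) (suc k)) ⟩
    (suc (toℕ i) % suc k + d % suc k) % suc k   ≡⟨ sym (%-distribˡ-+ (suc (toℕ i)) d (suc k)) ⟩
    (suc (toℕ i) + d) % suc k                   ≡⟨ cong (_% suc k) (sym (+-suc (toℕ i) d)) ⟩
    (toℕ i + suc d) % suc k                     ∎
    where open ≡-Reasoning

  iterate-next-reaches : ∀ {k} (i j : Fin (suc k)) → ∃[ d ] iterate (next G) i d ≡ j
  iterate-next-reaches {k} i j = d , toℕ-injective (begin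
    toℕ (iterate (next G) i d)                  ≡⟨ toℕ-iterate-next d i ⟩
    (toℕ i + (suc k ∸ toℕ i + toℕ j)) % suc k   ≡⟨ cong (_% suc k) (sym (+-assoc (toℕ i) _ (toℕ j))) ⟩
    (toℕ i + (suc k ∸ toℕ i) + toℕ j) % suc k   ≡⟨ cong (λ m → (m + toℕ j) % suc k) (m+[n∸m]≡n (<⇒≤ (toℕ<n i))) ⟩
    (suc k + toℕ j) % suc k                     ≡⟨ cong (_% suc k) (+-comm (suc k) (toℕ j)) ⟩
    (toℕ j + suc k) % suc k                     ≡⟨ [m+n]%n≡m%n (toℕ j) (suc k) ⟩
    toℕ j % suc k                               ≡⟨ m<n⇒m%n≡m (toℕ<n j) ⟩
    toℕ j                                       ∎)
    where
    open ≡-Reasoning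
    d : ℕ
    d = suc k ∸ toℕ i + toℕ j

  module _ {k} {P E : Fin (suc k) → Set} {i j : Fin (suc k)} (Pi : P i) (¬Pj : ¬ P j) where

    cyclic-leaves : (∀ l → P l → P (next G l) ⊎ E l) → ∃ E
    cyclic-leaves move with iterate-next-reaches i j
    ... | d , reaches-j with iterate-forward (next G) move d Pi
    ...   | inj₁ ∃E = ∃E
    ...   | inj₂ Pj = ⊥-elim (¬Pj (subst P reaches-j Pj))

    cyclic-enters : (∀ l → P (next G l) → P l ⊎ E l) → ∃ E
    cyclic-enters move with iterate-next-reaches j i
    ... | d , reaches-i with iterate-backward (next G) move d (subst P (sym reaches-i) Pi)
    ...   | inj₁ ∃E = ∃E
    ...   | inj₂ Pj = ⊥-elim (¬Pj Pj)

  module _ {C F : VSet G} (cut : IsFVC G C F) {S : VSet G} (cycle : CycleIn G S) where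
    open IsFVC cut
    open CycleIn cycle

    private
      R : VSet G
      R = ∁ (C ∪ F)

      ∈R⇒∉F : ∀ {v} → v ∈ R → v ∉ F
      ∈R⇒∉F v∈R v∈F = x∈∁p⇒x∉p v∈R (x∈p∪q⁺ (inj₂ v∈F))

    cycle-avoiding-C-avoids-F : (∀ i → vs i ∉ C) → ∀ i → vs i ∉ F
    cycle-avoiding-C-avoids-F vs∉C b vsb∈F with all? (λ i → vs i ∈? F)
    ... | yes vs∈F = forest (restrict cycle vs∈F)
    ... | no ¬vs∈F = exit≢entry (oneEdge t vsb∈F (es exit) (es entry) exit-edge entry-edge)
      where
      t : V G
      t = vs b

      InTree : Fin (suc k) → Set
      InTree i = Reach G F t (vs i)

      Exit Entry : Fin (suc k) → Set
      Exit  i = InTree i × vs (next G i) ∈ R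
      Entry i = vs i ∈ R × InTree (next G i)

      outside-F : ∃ λ r → vs r ∉ F
      outside-F = ¬∀⟶∃¬ (suc k) _ (λ i → vs i ∈? F) ¬vs∈F

      ∉F⇒∈R : ∀ i → vs i ∉ F → vs i ∈ R
      ∉F⇒∈R i vsi∉F = x∉p⇒x∈∁p ([ vs∉C i , vsi∉F ]′ ∘ x∈p∪q⁻ C F)

      ¬InTree-outside : ¬ InTree (proj₁ outside-F)
      ¬InTree-outside reach = proj₂ outside-F (Reach⇒∈ reach)

      forward : ∀ l → InTree l → InTree (next G l) ⊎ Exit l
      forward l reach with vs (next G l) ∈? F
      ... | yes vsnl∈F = inj₁ (step (es l) reach vsnl∈F (adj l))
      ... | no  vsnl∉F = inj₂ (reach , ∉F⇒∈R (next G l) vsnl∉F)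

      backward : ∀ l → InTree (next G l) → InTree l ⊎ Entry l
      backward l reach with vs l ∈? F
      ... | yes vsl∈F = inj₁ (step (es l) reach vsl∈F (Joins-sym (adj l)))
      ... | no  vsl∉F = inj₂ (∉F⇒∈R l vsl∉F , reach)

      exit-exists : ∃ Exit
      exit-exists = cyclic-leaves (here vsb∈F) ¬InTree-outside forward

      entry-exists : ∃ Entry
      entry-exists = cyclic-enters (here vsb∈F) ¬InTree-outside backward

      exit entry : Fin (suc k)
      exit  = proj₁ exit-exists
      entry = proj₁ entry-exists

      exit-edge : EdgeBetweenTreeAnd G F t R (es exit)
      exit-edge = let (reach , nxt∈R) = proj₂ exit-exists in
        vs exit , vs (next G exit) , adj exit , reach , nxt∈R

      entry-edge : EdgeBetweenTreeAnd G F t R (es entry)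
      entry-edge = let (vs∈R , reach) = proj₂ entry-exists in
        vs (next G entry) , vs entry , Joins-sym (adj entry) , reach , vs∈R

      exit≢entry : es exit ≡ es entry → ⊥
      exit≢entry eq = ∈R⇒∉F (proj₁ (proj₂ entry-exists))
        (subst (λ i → vs i ∈ F) (es-inj eq) (Reach⇒∈ (proj₁ (proj₂ exit-exists))))

  module _ {C₁ F₁ C₂ F₂ : VSet G} where

    crossing-isFVS : IsForest G F₁ → IsFVC G C₂ F₂ →
                     IsFVSOf G (C₁ ∪ F₁) ((C₁ ─ F₂) ∪ (C₂ ∩ F₁))
    crossing-isFVS forest₁ cut₂ = X⊆C₁∪F₁ , acyclic
      where
      X : VSet G
      X = (C₁ ─ F₂) ∪ (C₂ ∩ F₁)

      X⊆C₁∪F₁ : X ⊆ C₁ ∪ F₁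
      X⊆C₁∪F₁ x∈X with x∈p∪q⁻ (C₁ ─ F₂) (C₂ ∩ F₁) x∈X
      ... | inj₁ x∈C₁─F₂ = x∈p∪q⁺ (inj₁ (p─q⊆p C₁ F₂ x∈C₁─F₂))
      ... | inj₂ x∈C₂∩F₁ = x∈p∪q⁺ (inj₂ (proj₂ (x∈p∩q⁻ C₂ F₁ x∈C₂∩F₁)))

      acyclic : IsForest G ((C₁ ∪ F₁) ─ X)
      acyclic cycle = forest₁ (restrict cycle vs∈F₁)
        where
        open CycleIn cycle

        vs∉X : ∀ i → vs i ∉ X
        vs∉X i = x∈p─q⇒x∉q (C₁ ∪ F₁) X (vs-in i)

        vs∈C₁⇒∈F₂ : ∀ i → vs i ∈ C₁ → vs i ∈ F₂
        vs∈C₁⇒∈F₂ i vsi∈C₁ with vs i ∈? F₂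
        ... | yes vsi∈F₂ = vsi∈F₂
        ... | no  vsi∉F₂ = ⊥-elim (vs∉X i (x∈p∪q⁺ (inj₁ (x∈p∧x∉q⇒x∈p─q vsi∈C₁ vsi∉F₂))))

        vs∉C₂ : ∀ i → vs i ∉ C₂
        vs∉C₂ i vsi∈C₂ with x∈p∪q⁻ C₁ F₁ (p─q⊆p (C₁ ∪ F₁) X (vs-in i))
        ... | inj₁ vsi∈C₁ = IsFVC.disjoint cut₂ (vs i , x∈p∩q⁺ (vsi∈C₂ , vs∈C₁⇒∈F₂ i vsi∈C₁))
        ... | inj₂ vsi∈F₁ = vs∉X i (x∈p∪q⁺ (inj₂ (x∈p∩q⁺ (vsi∈C₂ , vsi∈F₁))))

        vs∈F₁ : ∀ i → vs i ∈ F₁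
        vs∈F₁ i with x∈p∪q⁻ C₁ F₁ (p─q⊆p (C₁ ∪ F₁) X (vs-in i))
        ... | inj₁ vsi∈C₁ = ⊥-elim (cycle-avoiding-C-avoids-F cut₂ cycle vs∉C₂ i (vs∈C₁⇒∈F₂ i vsi∈C₁))
        ... | inj₂ vsi∈F₁ = vsi∈F₁

    antler-crossing-≤ : IsAntler G C₁ F₁ → IsFVC G C₂ F₂ → ∣ C₁ ∩ F₂ ∣ ≤ ∣ C₂ ∩ F₁ ∣
    antler-crossing-≤ antler₁ cut₂ = +-cancelˡ-≤ (∣ C₁ ─ F₂ ∣) (∣ C₁ ∩ F₂ ∣) (∣ C₂ ∩ F₁ ∣) (begin
      ∣ C₁ ─ F₂ ∣ + ∣ C₁ ∩ F₂ ∣           ≡⟨ sym (∣p∣≡∣p─q∣+∣p∩q∣ C₁ F₂) ⟩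
      ∣ C₁ ∣                              ≤⟨ IsAntler.size antler₁ _ (crossing-isFVS forest₁ cut₂) ⟩
      ∣ (C₁ ─ F₂) ∪ (C₂ ∩ F₁) ∣           ≤⟨ ∣p∪q∣≤∣p∣+∣q∣ (C₁ ─ F₂) (C₂ ∩ F₁) ⟩
      ∣ C₁ ─ F₂ ∣ + ∣ C₂ ∩ F₁ ∣           ∎)
      where
      open ≤-Reasoning
      forest₁ : IsForest G F₁
      forest₁ = IsFVC.forest (IsAntler.fvc antler₁)

proposition9 : (G : Multigraph) → ∀ C₁ F₁ C₂ F₂ →
    IsAntler G C₁ F₁ → IsAntler G C₂ F₂ →
    ∣ C₁ ∩ F₂ ∣ ≡ ∣ C₂ ∩ F₁ ∣
proposition9 G C₁ F₁ C₂ F₂ antler₁ antler₂ =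
  ≤-antisym (antler-crossing-≤ G antler₁ (IsAntler.fvc antler₂))
            (antler-crossing-≤ G antler₂ (IsAntler.fvc antler₁))
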